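{- For every integer $n\geq 3$, $\lceil \log_2 n\rceil \leq \mathrm{sat}^*(n,\bowtie)\leq \binom{n}{2}+2n-1$.
   Context: $\bowtie$ (the butterfly) is the four-element poset on $\{A,B,C,D\}$ whose only strict relations are $A<B$, $A<D$, $C<B$, $C<D$ (so $A\parallel C$ and $B\parallel D$). $\mathcal{B}_n$ is the Boolean lattice $(2^{[n]},\subseteq)$. A poset $\mathcal{P}'=(P',\le')$ is an induced subposet of $\mathcal{P}=(P,\le)$ if there is an injection $f:P'\to P$ with $u\le' v$ iff $f(u)\le f(v)$. A family $\mathcal{F}\subseteq 2^{[n]}$ (ordered by inclusion) is induced-$\mathcal{P}$-saturated in $\mathcal{B}_n$ if it contains no induced copy of $\mathcal{P}$, but every $\mathcal{F}'$ with $\mathcal{F}\subsetneq\mathcal{F}'\subseteq 2^{[n]}$ contains an induced copy of $\mathcal{P}$. $\mathrm{sat}^*(n,\mathcal{P})$ is the minimum size of an induced-$\mathcal{P}$-saturated family in $\mathcal{B}_n$. -}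

module Defs where

open import Data.Bool using (Bool; true; false; T)
open import Data.Nat using (ℕ; zero; suc)
open import Data.Fin using (Fin; zero; suc)
open import Data.Fin.Subset using (Subset; _⊆_)
open import Data.Vec using (_∷_; [])
open import Data.List using (List; []; _∷_; map; _++_; filter; length)
open import Data.List.Relation.Unary.Any using (Any)
open import Data.Product using (Σ; ∃; _×_; _,_)
open import Function using (_⇔_)
open import Function.Definitions using (Injective)
open import Relation.Binary.PropositionalEquality using (_≡_)
open import Relation.Nullary using (¬_)
open import Relation.Unary using (Pred)

pattern ⋈A = zero
pattern ⋈B = suc zero
pattern ⋈C = suc (suc zero)
pattern ⋈D = suc (suc (suc zero))

bowtie≤ : Fin 4 → Fin 4 → Bool
bowtie≤ ⋈A ⋈A = true
bowtie≤ ⋈A ⋈B = true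
bowtie≤ ⋈A ⋈D = true
bowtie≤ ⋈C ⋈C = true
bowtie≤ ⋈C ⋈B = true
bowtie≤ ⋈C ⋈D = true
bowtie≤ ⋈B ⋈B = true
bowtie≤ ⋈D ⋈D = true
bowtie≤ _ _ = false

Family : ℕ → Set
Family n = Subset n → Bool

ContainsInducedBowtie : ∀ {n} → Family n → Set
ContainsInducedBowtie {n} F =
  Σ (Fin 4 → Subset n) λ f →
    Injective _≡_ _≡_ f ×
    (∀ x → T (F (f x))) ×
    (∀ x y → (T (bowtie≤ x y) ⇔ (f x ⊆ f y)))

_⊂F_ : ∀ {n} → Family n → Family n → Set
F ⊂F F' = (∀ S → T (F S) → T (F' S)) × ∃ λ S → T (F' S) × ¬ T (F S)

InducedBowtieSaturated : ∀ {n} → Family n → Set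
InducedBowtieSaturated {n} F =
  ¬ ContainsInducedBowtie F ×
  (∀ (F' : Family n) → F ⊂F F' → ContainsInducedBowtie F')

-- All 2^n subsets of Fin n, each exactly once.
allSubsets : ∀ n → List (Subset n)
allSubsets zero = [] ∷ []
allSubsets (suc n) = map (false ∷_) (allSubsets n) ++ map (true ∷_) (allSubsets n)

size : ∀ {n} → Family n → ℕ
size {n} F = length (filter (λ S → Data.Bool._≟_ (F S) true) (allSubsets n))

module Submission where

-- In a saturated family F any two points i ≠ j are separated by a member of F.
-- Otherwise take U ∈ F of maximum size avoiding i and j (there is one: ∅ ∈ F, as ∅ would be a least
-- element of any butterfly containing it, and the butterfly has none). Then U ∪ {i} ∉ F, so adding it
-- creates a butterfly in which U ∪ {i} can be replaced by U, giving a butterfly inside F.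
-- Hence the membership pattern of a point in the members of F determines it, and n ≤ 2 ^ ∣ F ∣.
--
-- The sets of size at most 2 together with the suffixes {k, …, n-1} form a family of
-- size C(n,2) + 2n - 1. It has no butterfly: a top element of size at most 2 is the union of the two
-- bottom elements, hence below the other top; and two suffixes are comparable. It is saturated: a new
-- set S, neither small nor a suffix, forms a butterfly with two of its points and the suffix starting
-- just after its least point.

open import Defs
open import Data.Bool using (Bool; true; false; T; _∨_; _∧_)
open import Data.Bool.Properties using (T-≡; T-∨)
import Data.Bool as Bool
open import Data.Nat using (ℕ; zero; suc; _+_; _*_; _∸_; _^_; _≤_; _<_; _<ᵇ_; s≤s; z≤n)
open import Data.Nat.Properties using (+-suc; +-comm; ≤-trans; ≤-reflexive; <⇒≱; ≮⇒≥; <ᵇ⇒<; <⇒<ᵇ; m+n∸n≡m)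
open import Data.Nat.Combinatorics using (_C_; nC1≡n; nCk+nC[k+1]≡[n+1]C[k+1])
open import Data.Nat.Logarithm using (⌈log₂_⌉; ⌈log₂⌉-mono-≤; ⌈log₂2^n⌉≡n)
open import Data.Nat.Tactic.RingSolver using (solve-∀)
open import Data.Fin using (Fin; zero; suc; _≟_; combine)
open import Data.Fin.Properties using (any?; suc-injective; combine-injective; injective⇒≤)
open import Data.Fin.Subset
  using (Subset; inside; outside; ⊥; ⊤; ⁅_⁆; _∪_; _∩_; _-_; ∣_∣; _∈_; _∉_; _⊆_; _⊈_; Nonempty)
open import Data.Fin.Subset.Properties
  using ( _∈?_; ∉⊥; ∈⊤; ⊥⊆; ⊆-refl; ⊆-reflexive; ⊆-trans; s⊆s; drop-there; drop-∷-⊆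
        ; x∈⁅x⁆; x∈⁅y⁆⇒x≡y; ∣⁅x⁆∣≡1; p⊆p∪q; x∈p∪q⁺; x∈p∪q⁻; x∈p∩q⁻; ∩-identityʳ
        ; x∈p∧x≢y⇒x∈p-y; x∈p⇒∣p-x∣<∣p∣; p⊂q⇒∣p∣<∣q∣)
open import Data.Vec using ([]; _∷_; here; there; lookup)
open import Data.Vec.Properties using (≡-dec; []=⇒lookup; lookup⇒[]=)
open import Data.Vec.Functional using (updateAt)
open import Data.Vec.Functional.Properties using (updateAt-updates; updateAt-minimal)
open import Data.List using (List; []; _∷_; map; filter; length; _++_)
open import Data.List.Properties using (filter-++; length-++)
open import Data.List.Membership.Propositional using () renaming (_∈_ to _∈ₗ_)
open import Data.List.Membership.Propositional.Properties using (∈-map⁺; ∈-++⁺ˡ; ∈-++⁺ʳ; ∈-filter⁺)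
open import Data.List.Relation.Unary.All using (All; []; _∷_)
import Data.List.Relation.Unary.All as All
open import Data.List.Relation.Unary.All.Properties using (all-filter)
open import Data.List.Relation.Unary.Any using (here)
open import Data.List.Extrema.Nat using (argmax; argmax-all; f[xs]≤f[argmax])
open import Data.Product using (Σ; ∃; ∃₂; _×_; _,_; proj₁; proj₂)
open import Data.Sum using (_⊎_; inj₁; inj₂; [_,_])
import Data.Sum as Sum
open import Data.Unit using (tt)
open import Data.Empty using (⊥-elim)
import Data.Empty
open import Function using (_∘_; _⇔_; mk⇔; Equivalence; const; id)
open import Function.Definitions using (Injective)
open import Level using (0ℓ)
open import Relation.Binary.PropositionalEquality
  using (_≡_; _≢_; refl; sym; trans; cong; cong₂; subst; ≢-sym; module ≡-Reasoning)
open import Relation.Nullary using (¬_; does; yes; no; ¬?; contradiction)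
open import Relation.Nullary.Decidable using (_×-dec_; ⌊_⌋; toWitness; fromWitness; decidable-stable)
open import Relation.Unary using (Pred; Decidable)

open Equivalence using (to; from)

module _ {A B : Set} {P : Pred B 0ℓ} (P? : Decidable P) (g : A → B) where

  length-filter-map : ∀ xs → length (filter P? (map g xs)) ≡ length (filter (P? ∘ g) xs)
  length-filter-map [] = refl
  length-filter-map (x ∷ xs) with does (P? (g x))
  ... | true = cong suc (length-filter-map xs)
  ... | false = length-filter-map xs

module _ {A : Set} (P Q : A → Bool) where

  length-filter-∨ : (∀ x → T (P x) → ¬ T (Q x)) → ∀ xs →
    length (filter (λ x → P x ∨ Q x Bool.≟ true) xs) ≡
    length (filter (λ x → P x Bool.≟ true) xs) + length (filter (λ x → Q x Bool.≟ true) xs)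
  length-filter-∨ disjoint [] = refl
  length-filter-∨ disjoint (x ∷ xs) with P x in px | Q x in qx
  ... | true  | true  = ⊥-elim (disjoint x (subst T (sym px) _) (subst T (sym qx) _))
  ... | true  | false = cong suc (length-filter-∨ disjoint xs)
  ... | false | true  = trans (cong suc (length-filter-∨ disjoint xs)) (sym (+-suc _ _))
  ... | false | false = length-filter-∨ disjoint xs

members : ∀ {n} → Family n → List (Subset n)
members {n} F = filter (λ X → F X Bool.≟ true) (allSubsets n)

∈-allSubsets : ∀ {n} (X : Subset n) → X ∈ₗ allSubsets n
∈-allSubsets [] = here refl
∈-allSubsets {suc n} (outside ∷ X) = ∈-++⁺ˡ (∈-map⁺ (outside ∷_) (∈-allSubsets X))
∈-allSubsets {suc n} (inside ∷ X) =
  ∈-++⁺ʳ (map (outside ∷_) (allSubsets n)) (∈-map⁺ (inside ∷_) (∈-allSubsets X))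

∈-members : ∀ {n} {F : Family n} {X} → T (F X) → X ∈ₗ members F
∈-members {X = X} X∈F = ∈-filter⁺ _ (∈-allSubsets X) (to T-≡ X∈F)

size-∷ : ∀ {n} (F : Family (suc n)) → size F ≡ size (F ∘ (outside ∷_)) + size (F ∘ (inside ∷_))
size-∷ {n} F = begin
  length (filter P? (map (outside ∷_) all ++ map (inside ∷_) all))
    ≡⟨ cong length (filter-++ P? (map (outside ∷_) all) _) ⟩
  length (filter P? (map (outside ∷_) all) ++ filter P? (map (inside ∷_) all))
    ≡⟨ length-++ (filter P? (map (outside ∷_) all)) ⟩
  length (filter P? (map (outside ∷_) all)) + length (filter P? (map (inside ∷_) all))
    ≡⟨ cong₂ _+_ (length-filter-map P? _ all) (length-filter-map P? _ all) ⟩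
  size (F ∘ (outside ∷_)) + size (F ∘ (inside ∷_)) ∎
  where
  open ≡-Reasoning
  all = allSubsets n
  P? = λ X → F X Bool.≟ true

size-∨ : ∀ {n} (F G : Family n) → (∀ X → T (F X) → ¬ T (G X)) →
  size (λ X → F X ∨ G X) ≡ size F + size G
size-∨ {n} F G disjoint = length-filter-∨ F G disjoint (allSubsets n)

size-empty : ∀ n → size {n} (λ _ → false) ≡ 0
size-empty zero = refl
size-empty (suc n) = trans (size-∷ {n} (λ _ → false)) (cong₂ _+_ (size-empty n) (size-empty n))

size-∣∣<1 : ∀ n → size {n} (λ X → ∣ X ∣ <ᵇ 1) ≡ 1
size-∣∣<1 zero = refl
size-∣∣<1 (suc n) = trans (size-∷ {n} (λ X → ∣ X ∣ <ᵇ 1)) (cong₂ _+_ (size-∣∣<1 n) (size-empty n))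

size-∣∣<2 : ∀ n → size {n} (λ X → ∣ X ∣ <ᵇ 2) ≡ suc n
size-∣∣<2 zero = refl
size-∣∣<2 (suc n) =
  trans (size-∷ {n} (λ X → ∣ X ∣ <ᵇ 2)) (trans (cong₂ _+_ (size-∣∣<2 n) (size-∣∣<1 n)) (+-comm (suc n) 1))

x∈p⇒⁅x⁆⊆p : ∀ {n} {p : Subset n} {x} → x ∈ p → ⁅ x ⁆ ⊆ p
x∈p⇒⁅x⁆⊆p {p = p} {x} x∈p y∈⁅x⁆ = subst (_∈ p) (sym (x∈⁅y⁆⇒x≡y x y∈⁅x⁆)) x∈p

∈∧≢⇒⊈⁅⁆ : ∀ {n} {p : Subset n} {x y} → x ∈ p → x ≢ y → p ⊈ ⁅ y ⁆
∈∧≢⇒⊈⁅⁆ {y = y} x∈p x≢y p⊆⁅y⁆ = x≢y (x∈⁅y⁆⇒x≡y y (p⊆⁅y⁆ x∈p))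

⊈⇒∃∉ : ∀ {n} {p q : Subset n} → p ⊈ q → ∃ λ x → x ∈ p × x ∉ q
⊈⇒∃∉ {p = p} {q} p⊈q with any? (λ x → x ∈? p ×-dec ¬? (x ∈? q))
... | yes witness = witness
... | no none = ⊥-elim (p⊈q λ {x} x∈p → decidable-stable (x ∈? q) (λ x∉q → none (x , x∈p , x∉q)))

⊆∧∣∣≤⇒⊇ : ∀ {n} {p q : Subset n} → p ⊆ q → ∣ q ∣ ≤ ∣ p ∣ → q ⊆ p
⊆∧∣∣≤⇒⊇ {p = p} p⊆q ∣q∣≤∣p∣ {x} x∈q with x ∈? p
... | yes x∈p = x∈p
... | no x∉p = contradiction ∣q∣≤∣p∣ (<⇒≱ (p⊂q⇒∣p∣<∣q∣ (p⊆q , x , x∈q , x∉p)))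

three-members⇒3≤∣p∣ : ∀ {n} {p : Subset n} {a b c} → a ∈ p → b ∈ p → c ∈ p →
  a ≢ b → a ≢ c → b ≢ c → 3 ≤ ∣ p ∣
three-members⇒3≤∣p∣ a∈p b∈p c∈p a≢b a≢c b≢c = grow a∈p (grow b∈p-a (grow c∈p-a-b z≤n))
  where
  grow : ∀ {n k} {q : Subset n} {x} → x ∈ q → k ≤ ∣ q - x ∣ → suc k ≤ ∣ q ∣
  grow x∈q k≤ = ≤-trans (s≤s k≤) (x∈p⇒∣p-x∣<∣p∣ x∈q)
  b∈p-a = x∈p∧x≢y⇒x∈p-y b∈p (≢-sym a≢b)
  c∈p-a-b = x∈p∧x≢y⇒x∈p-y (x∈p∧x≢y⇒x∈p-y c∈p (≢-sym a≢c)) (≢-sym b≢c)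

1≤∣p∣⇒nonempty : ∀ {n} {p : Subset n} → 1 ≤ ∣ p ∣ → Nonempty p
1≤∣p∣⇒nonempty {p = inside ∷ p} _ = zero , here
1≤∣p∣⇒nonempty {p = outside ∷ p} 1≤∣p∣ with 1≤∣p∣⇒nonempty 1≤∣p∣
... | x , x∈p = suc x , there x∈p

2≤∣p∣⇒two-members : ∀ {n} {p : Subset n} → 2 ≤ ∣ p ∣ → ∃₂ λ a c → a ≢ c × a ∈ p × c ∈ p
2≤∣p∣⇒two-members {p = inside ∷ p} (s≤s 1≤∣p∣) with 1≤∣p∣⇒nonempty 1≤∣p∣
... | c , c∈p = zero , suc c , (λ ()) , here , there c∈p
2≤∣p∣⇒two-members {p = outside ∷ p} 2≤∣p∣ with 2≤∣p∣⇒two-members 2≤∣p∣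
... | a , c , a≢c , a∈p , c∈p = suc a , suc c , a≢c ∘ suc-injective , there a∈p , there c∈p

maximum-size : ∀ {n} {P : Pred (Subset n) 0ℓ} → Decidable P → ∀ {X₀} → P X₀ →
  ∃ λ U → P U × ∀ V → P V → ∣ V ∣ ≤ ∣ U ∣
maximum-size {n} P? {X₀} P[X₀] =
  U , argmax-all ∣_∣ P[X₀] (all-filter P? (allSubsets n)) ,
  λ V P[V] → All.lookup (f[xs]≤f[argmax] X₀ candidates) (∈-filter⁺ P? (∈-allSubsets V) P[V])
  where
  candidates = filter P? (allSubsets n)
  U = argmax ∣_∣ X₀ candidates

isFull : ∀ {n} → Subset n → Bool
isFull [] = true
isFull (s ∷ p) = s ∧ isFull p

size-isFull : ∀ n → size {n} isFull ≡ 1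
size-isFull zero = refl
size-isFull (suc n) = trans (size-∷ {n} isFull) (cong₂ _+_ (size-empty n) (size-isFull n))

⊆-full : ∀ {n} {p q : Subset n} → T (isFull p) → q ⊆ p
⊆-full {p = inside ∷ p} _ here = here
⊆-full {p = inside ∷ p} p-full (there x∈q) = there (⊆-full p-full x∈q)

isFull-⊤ : ∀ n → T (isFull (⊤ {n}))
isFull-⊤ zero = tt
isFull-⊤ (suc n) = isFull-⊤ n

¬isFull⇒∃∉ : ∀ {n} {p : Subset n} → ¬ T (isFull p) → ∃ λ x → x ∉ p
¬isFull⇒∃∉ {p = []} p-not-full = ⊥-elim (p-not-full tt)
¬isFull⇒∃∉ {p = outside ∷ p} _ = zero , λ ()
¬isFull⇒∃∉ {p = inside ∷ p} p-not-full with ¬isFull⇒∃∉ p-not-full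
... | x , x∉p = suc x , x∉p ∘ drop-there

_≤⋈_ : Fin 4 → Fin 4 → Set
x ≤⋈ y = T (bowtie≤ x y)

≤⋈-refl : ∀ x → x ≤⋈ x
≤⋈-refl ⋈A = tt
≤⋈-refl ⋈B = tt
≤⋈-refl ⋈C = tt
≤⋈-refl ⋈D = tt

≤⋈-antisym : ∀ x y → x ≤⋈ y → y ≤⋈ x → x ≡ y
≤⋈-antisym ⋈A ⋈A _ _ = refl
≤⋈-antisym ⋈B ⋈B _ _ = refl
≤⋈-antisym ⋈C ⋈C _ _ = refl
≤⋈-antisym ⋈D ⋈D _ _ = refl
≤⋈-antisym ⋈A ⋈B _ ()
≤⋈-antisym ⋈A ⋈C ()
≤⋈-antisym ⋈A ⋈D _ ()
≤⋈-antisym ⋈B ⋈A ()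
≤⋈-antisym ⋈B ⋈C ()
≤⋈-antisym ⋈B ⋈D ()
≤⋈-antisym ⋈C ⋈A ()
≤⋈-antisym ⋈C ⋈B _ ()
≤⋈-antisym ⋈C ⋈D _ ()
≤⋈-antisym ⋈D ⋈A ()
≤⋈-antisym ⋈D ⋈B ()
≤⋈-antisym ⋈D ⋈C ()

≤⋈-no-least : ∀ x → ∃ λ y → ¬ x ≤⋈ y
≤⋈-no-least ⋈A = ⋈C , λ ()
≤⋈-no-least ⋈B = ⋈A , λ ()
≤⋈-no-least ⋈C = ⋈A , λ ()
≤⋈-no-least ⋈D = ⋈A , λ ()

≤⋈-another-lower-bound : ∀ z x → z ≢ x → z ≤⋈ x → ∃ λ w → w ≢ x × w ≤⋈ x × ¬ w ≤⋈ z
≤⋈-another-lower-bound ⋈A ⋈B _ _ = ⋈C , (λ ()) , tt , λ ()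
≤⋈-another-lower-bound ⋈A ⋈D _ _ = ⋈C , (λ ()) , tt , λ ()
≤⋈-another-lower-bound ⋈C ⋈B _ _ = ⋈A , (λ ()) , tt , λ ()
≤⋈-another-lower-bound ⋈C ⋈D _ _ = ⋈A , (λ ()) , tt , λ ()
≤⋈-another-lower-bound ⋈A ⋈A z≢x _ = ⊥-elim (z≢x refl)
≤⋈-another-lower-bound ⋈B ⋈B z≢x _ = ⊥-elim (z≢x refl)
≤⋈-another-lower-bound ⋈C ⋈C z≢x _ = ⊥-elim (z≢x refl)
≤⋈-another-lower-bound ⋈D ⋈D z≢x _ = ⊥-elim (z≢x refl)
≤⋈-another-lower-bound ⋈A ⋈C _ ()
≤⋈-another-lower-bound ⋈B ⋈A _ ()
≤⋈-another-lower-bound ⋈B ⋈C _ ()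
≤⋈-another-lower-bound ⋈B ⋈D _ ()
≤⋈-another-lower-bound ⋈C ⋈A _ ()
≤⋈-another-lower-bound ⋈D ⋈A _ ()
≤⋈-another-lower-bound ⋈D ⋈B _ ()
≤⋈-another-lower-bound ⋈D ⋈C _ ()

IsBowtie : ∀ {n} → (Fin 4 → Subset n) → Set
IsBowtie f = ∀ x y → x ≤⋈ y ⇔ f x ⊆ f y

IsBowtie⇒injective : ∀ {n} {f : Fin 4 → Subset n} → IsBowtie f → Injective _≡_ _≡_ f
IsBowtie⇒injective f-bowtie {x} {y} fx≡fy =
  ≤⋈-antisym x y (from (f-bowtie x y) (⊆-reflexive fx≡fy)) (from (f-bowtie y x) (⊆-reflexive (sym fx≡fy)))

induced-copy : ∀ {n} {F : Family n} {f : Fin 4 → Subset n} → IsBowtie f → (∀ x → T (F (f x))) →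
  ContainsInducedBowtie F
induced-copy f-bowtie f∈F = _ , IsBowtie⇒injective f-bowtie , f∈F , f-bowtie

⟨_,_,_,_⟩ : ∀ {n} → Subset n → Subset n → Subset n → Subset n → Fin 4 → Subset n
⟨ A , B , C , D ⟩ ⋈A = A
⟨ A , B , C , D ⟩ ⋈B = B
⟨ A , B , C , D ⟩ ⋈C = C
⟨ A , B , C , D ⟩ ⋈D = D

IsBowtie-intro : ∀ {n} {A B C D : Subset n} →
  A ⊆ B → A ⊆ D → C ⊆ B → C ⊆ D →
  A ⊈ C → C ⊈ A → B ⊈ D → D ⊈ B → B ⊈ A → B ⊈ C → D ⊈ A → D ⊈ C →
  IsBowtie ⟨ A , B , C , D ⟩
IsBowtie-intro {n} A⊆B A⊆D C⊆B C⊆D A⊈C C⊈A B⊈D D⊈B B⊈A B⊈C D⊈A D⊈C = order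
  where
  holds : {X Y : Subset n} → X ⊆ Y → T true ⇔ X ⊆ Y
  holds {X} {Y} X⊆Y = mk⇔ {B = X ⊆ Y} (λ _ → X⊆Y) (λ _ → tt)
  fails : {X Y : Subset n} → X ⊈ Y → T false ⇔ X ⊆ Y
  fails X⊈Y = mk⇔ (λ ()) (⊥-elim ∘ X⊈Y)
  order : IsBowtie ⟨ _ , _ , _ , _ ⟩
  order ⋈A ⋈A = holds ⊆-refl
  order ⋈A ⋈B = holds A⊆B
  order ⋈A ⋈C = fails A⊈C
  order ⋈A ⋈D = holds A⊆D
  order ⋈B ⋈A = fails B⊈A
  order ⋈B ⋈B = holds ⊆-refl
  order ⋈B ⋈C = fails B⊈C
  order ⋈B ⋈D = fails B⊈D
  order ⋈C ⋈A = fails C⊈A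
  order ⋈C ⋈B = holds C⊆B
  order ⋈C ⋈C = holds ⊆-refl
  order ⋈C ⋈D = holds C⊆D
  order ⋈D ⋈A = fails D⊈A
  order ⋈D ⋈B = fails D⊈B
  order ⋈D ⋈C = fails D⊈C
  order ⋈D ⋈D = holds ⊆-refl

IsBowtie-replace : ∀ {n} {f : Fin 4 → Subset n} {x U} → IsBowtie f →
  (∀ z → z ≢ x → (x ≤⋈ z ⇔ U ⊆ f z) × (z ≤⋈ x ⇔ f z ⊆ U)) →
  IsBowtie (updateAt f x (const U))
IsBowtie-replace {f = f} {x} {U} f-bowtie U-fits y z with y ≟ x | z ≟ x
... | yes refl | yes refl rewrite updateAt-updates y {const U} f =
  mk⇔ {B = U ⊆ U} (λ _ → ⊆-refl) (λ _ → ≤⋈-refl y)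
... | yes refl | no z≢x rewrite updateAt-updates y {const U} f | updateAt-minimal z y {const U} f z≢x =
  proj₁ (U-fits z z≢x)
... | no y≢x | yes refl rewrite updateAt-updates z {const U} f | updateAt-minimal y z {const U} f y≢x =
  proj₂ (U-fits y y≢x)
... | no y≢x | no z≢x rewrite updateAt-minimal y x {const U} f y≢x | updateAt-minimal z x {const U} f z≢x =
  f-bowtie y z

insert : ∀ {n} → Subset n → Family n → Family n
insert S F X = F X ∨ ⌊ ≡-dec Bool._≟_ X S ⌋

⊂F-insert : ∀ {n} {F : Family n} {S} → ¬ T (F S) → F ⊂F insert S F
⊂F-insert {F = F} {S} S∉F =
  (λ X X∈F → from (T-∨ {F X}) (inj₁ X∈F)) , S , from (T-∨ {F S}) (inj₂ (fromWitness refl)) , S∉F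

∈-insert⁻ : ∀ {n} (F : Family n) {S X} → T (insert S F X) → T (F X) ⊎ X ≡ S
∈-insert⁻ F {X = X} X∈F+S = Sum.map₂ toWitness (to (T-∨ {F X}) X∈F+S)

module _ {n} {F : Family n} (F-saturated : InducedBowtieSaturated F) where

  copy-through : ∀ {S} → ¬ T (F S) →
    ∃₂ λ f x → IsBowtie f × f x ≡ S × ∀ y → y ≢ x → T (F (f y))
  copy-through {S} S∉F with proj₂ F-saturated (insert S F) (⊂F-insert S∉F)
  ... | f , _ , f∈F+S , f-bowtie with any? (λ x → ≡-dec Bool._≟_ (f x) S)
  ... | no none = ⊥-elim (proj₁ F-saturated (induced-copy {F = F} f-bowtie f∈F))
    where
    f∈F : ∀ y → T (F (f y))
    f∈F y = [ id , (λ fy≡S → ⊥-elim (none (y , fy≡S))) ] (∈-insert⁻ F (f∈F+S y))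
  ... | yes (x , fx≡S) = f , x , f-bowtie , fx≡S , others
    where
    others : ∀ y → y ≢ x → T (F (f y))
    others y y≢x with ∈-insert⁻ F (f∈F+S y)
    ... | inj₁ fy∈F = fy∈F
    ... | inj₂ fy≡S = ⊥-elim (y≢x (IsBowtie⇒injective f-bowtie (trans fy≡S (sym fx≡S))))

  ⊥∈saturated : T (F ⊥)
  ⊥∈saturated with Bool.T? (F ⊥)
  ... | yes ⊥∈F = ⊥∈F
  ... | no ⊥∉F with copy-through ⊥∉F
  ... | f , x , f-bowtie , fx≡⊥ , _ with ≤⋈-no-least x
  ... | y , x≰y = ⊥-elim (x≰y (from (f-bowtie x y) (subst (_⊆ f y) (sym fx≡⊥) ⊥⊆)))

∈-transfer : ∀ {n} {X : Subset n} {i j} → lookup X i ≡ lookup X j → i ∈ X → j ∈ X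
∈-transfer {X = X} {i} {j} Xi≡Xj i∈X = lookup⇒[]= j X (trans (sym Xi≡Xj) ([]=⇒lookup i∈X))

module Twins {n} {F : Family n} (F-saturated : InducedBowtieSaturated F)
  {i j : Fin n} (i≢j : i ≢ j) (twins : ∀ X → T (F X) → lookup X i ≡ lookup X j)
  {U : Subset n} (U∈F : T (F U)) (i∉U : i ∉ U) (j∉U : j ∉ U)
  (U-max : ∀ V → T (F V) → i ∉ V → j ∉ V → ∣ V ∣ ≤ ∣ U ∣) where

  S : Subset n
  S = U ∪ ⁅ i ⁆

  U⊆S : U ⊆ S
  U⊆S = p⊆p∪q ⁅ i ⁆

  i∈S : i ∈ S
  i∈S = x∈p∪q⁺ (inj₂ (x∈⁅x⁆ i))

  j∉S : j ∉ S
  j∉S j∈S = [ j∉U , (λ j∈⁅i⁆ → i≢j (sym (x∈⁅y⁆⇒x≡y i j∈⁅i⁆))) ] (x∈p∪q⁻ U ⁅ i ⁆ j∈S)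

  S∉F : ¬ T (F S)
  S∉F S∈F = j∉S (∈-transfer (twins S S∈F) i∈S)

  ⊆S⇒⊆U : ∀ {V} → T (F V) → V ⊆ S → V ⊆ U
  ⊆S⇒⊆U {V} V∈F V⊆S {x} x∈V with x∈p∪q⁻ U ⁅ i ⁆ (V⊆S x∈V)
  ... | inj₁ x∈U = x∈U
  ... | inj₂ x∈⁅i⁆ = ⊥-elim (j∉S (V⊆S (∈-transfer (twins V V∈F) i∈V)))
    where
    i∈V : i ∈ V
    i∈V = subst (_∈ V) (x∈⁅y⁆⇒x≡y i x∈⁅i⁆) x∈V

  ⊇U⇒⊆U⊎⊇S : ∀ {V} → T (F V) → U ⊆ V → V ⊆ U ⊎ S ⊆ V
  ⊇U⇒⊆U⊎⊇S {V} V∈F U⊆V with i ∈? V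
  ... | yes i∈V = inj₂ λ x∈S → [ U⊆V , (λ x∈⁅i⁆ → subst (_∈ V) (sym (x∈⁅y⁆⇒x≡y i x∈⁅i⁆)) i∈V) ]
                                 (x∈p∪q⁻ U ⁅ i ⁆ x∈S)
  ... | no i∉V = inj₁ (⊆∧∣∣≤⇒⊇ U⊆V (U-max V V∈F i∉V (i∉V ∘ ∈-transfer (sym (twins V V∈F)))))

  copy-in-F : ContainsInducedBowtie F
  copy-in-F with copy-through F-saturated S∉F
  ... | f , x , f-bowtie , fx≡S , others = induced-copy {F = F} (IsBowtie-replace f-bowtie U-fits) g∈F
    where
    U⊆fx : U ⊆ f x
    U⊆fx = ⊆-trans U⊆S (⊆-reflexive (sym fx≡S))

    below-x⇒⊆U : ∀ {y} → y ≢ x → y ≤⋈ x → f y ⊆ U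
    below-x⇒⊆U {y} y≢x y≤x = ⊆S⇒⊆U (others y y≢x) (⊆-trans (to (f-bowtie y x) y≤x) (⊆-reflexive fx≡S))

    -- If f z ⊆ U, then z lies below x, and the other lower bound w of x gives f w ⊆ U ⊆ f z.
    ⊇U⇒x≤ : ∀ {z} → z ≢ x → U ⊆ f z → x ≤⋈ z
    ⊇U⇒x≤ {z} z≢x U⊆fz with ⊇U⇒⊆U⊎⊇S (others z z≢x) U⊆fz
    ... | inj₂ S⊆fz = from (f-bowtie x z) (⊆-trans (⊆-reflexive fx≡S) S⊆fz)
    ... | inj₁ fz⊆U with ≤⋈-another-lower-bound z x z≢x (from (f-bowtie z x) (⊆-trans fz⊆U U⊆fx))
    ...   | w , w≢x , w≤x , w≰z = ⊥-elim (w≰z (from (f-bowtie w z) (⊆-trans (below-x⇒⊆U w≢x w≤x) U⊆fz)))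

    U-fits : ∀ z → z ≢ x → (x ≤⋈ z ⇔ U ⊆ f z) × (z ≤⋈ x ⇔ f z ⊆ U)
    U-fits z z≢x =
      mk⇔ {B = U ⊆ f z} (⊆-trans U⊆fx ∘ to (f-bowtie x z)) (⊇U⇒x≤ z≢x) ,
      mk⇔ {B = f z ⊆ U} (below-x⇒⊆U z≢x) (λ fz⊆U → from (f-bowtie z x) (⊆-trans fz⊆U U⊆fx))

    g∈F : ∀ y → T (F (updateAt f x (const U) y))
    g∈F y with y ≟ x
    ... | yes refl = subst (T ∘ F) (sym (updateAt-updates y {const U} f)) U∈F
    ... | no y≢x = subst (T ∘ F) (sym (updateAt-minimal y x {const U} f y≢x)) (others y y≢x)

saturated⇒separating : ∀ {n} {F : Family n} → InducedBowtieSaturated F →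
  ∀ {i j} → (∀ X → T (F X) → lookup X i ≡ lookup X j) → i ≡ j
saturated⇒separating {F = F} F-saturated {i} {j} twins with i ≟ j
... | yes i≡j = i≡j
... | no i≢j with maximum-size (λ X → Bool.T? (F X) ×-dec ¬? (i ∈? X) ×-dec ¬? (j ∈? X))
                               (⊥∈saturated F-saturated , ∉⊥ , ∉⊥)
... | U , (U∈F , i∉U , j∉U) , U-max =
  ⊥-elim (proj₁ F-saturated (Twins.copy-in-F F-saturated i≢j twins U∈F i∉U j∉U
    (λ V V∈F i∉V j∉V → U-max V (V∈F , i∉V , j∉V))))

bit : Bool → Fin 2
bit false = zero
bit true = suc zero

bit-injective : Injective _≡_ _≡_ bit
bit-injective {false} {false} _ = refl
bit-injective {true} {true} _ = refl

code : ∀ {n} (L : List (Subset n)) → Fin n → Fin (2 ^ length L)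
code [] i = zero
code (X ∷ L) i = combine (bit (lookup X i)) (code L i)

code≡⇒agree : ∀ {n} (L : List (Subset n)) {i j} → code L i ≡ code L j → All (λ X → lookup X i ≡ lookup X j) L
code≡⇒agree [] _ = []
code≡⇒agree (X ∷ L) {i} {j} code≡ with combine-injective _ (code L i) _ (code L j) code≡
... | bit≡ , rest≡ = bit-injective bit≡ ∷ code≡⇒agree L rest≡

saturated⇒n≤2^size : ∀ {n} {F : Family n} → InducedBowtieSaturated F → n ≤ 2 ^ size F
saturated⇒n≤2^size {F = F} F-saturated = injective⇒≤ {f = code (members F)} λ code≡ →
  saturated⇒separating F-saturated λ X X∈F → All.lookup (code≡⇒agree (members F) code≡) (∈-members X∈F)

-- The suffixes {k, …, n-1}: in the vector encoding, a run of outsides followed by insides only.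
isSuffix : ∀ {n} → Subset n → Bool
isSuffix [] = true
isSuffix (outside ∷ p) = isSuffix p
isSuffix (inside ∷ p) = isFull p

isFull⇒isSuffix : ∀ {n} {p : Subset n} → T (isFull p) → T (isSuffix p)
isFull⇒isSuffix {p = []} _ = tt
isFull⇒isSuffix {p = inside ∷ p} p-full = p-full

suffixes-chain : ∀ {n} (p q : Subset n) → T (isSuffix p) → T (isSuffix q) → p ⊆ q ⊎ q ⊆ p
suffixes-chain [] [] _ _ = inj₁ ⊆-refl
suffixes-chain (outside ∷ p) (outside ∷ q) p-suffix q-suffix =
  Sum.map s⊆s s⊆s (suffixes-chain p q p-suffix q-suffix)
suffixes-chain (s ∷ p) (inside ∷ q) _ q-full = inj₁ (⊆-full {p = inside ∷ q} q-full)
suffixes-chain (inside ∷ p) (outside ∷ q) p-full _ = inj₂ (⊆-full {p = inside ∷ p} p-full)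

-- Written with _<ᵇ_ so that ∣ inside ∷ X ∣ <ᵇ 3 reduces to ∣ X ∣ <ᵇ 2, which drives size-smallOrSuffix.
smallOrSuffix : ∀ {n} → Family n
smallOrSuffix X = (∣ X ∣ <ᵇ 3) ∨ isSuffix X

small-not-full : ∀ {m} (X : Subset (2 + m)) → T (∣ X ∣ <ᵇ 2) → ¬ T (isFull X)
small-not-full (outside ∷ X) _ ()
small-not-full (inside ∷ outside ∷ X) _ ()
small-not-full (inside ∷ inside ∷ X) ()

size-smallOrSuffix : ∀ m → size {2 + m} smallOrSuffix + 1 ≡ (2 + m) C 2 + 2 * (2 + m)
size-smallOrSuffix zero = refl
size-smallOrSuffix (suc m) = begin
  size {3 + m} smallOrSuffix + 1
    ≡⟨ cong (_+ 1) (size-∷ {2 + m} smallOrSuffix) ⟩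
  size {2 + m} smallOrSuffix + size {2 + m} (λ X → (∣ X ∣ <ᵇ 2) ∨ isFull X) + 1
    ≡⟨ cong (λ k → size {2 + m} smallOrSuffix + k + 1)
         (trans (size-∨ {2 + m} _ _ small-not-full) (cong₂ _+_ (size-∣∣<2 (2 + m)) (size-isFull (2 + m)))) ⟩
  size {2 + m} smallOrSuffix + (3 + m + 1) + 1
    ≡⟨ regroup (size {2 + m} smallOrSuffix) m ⟩
  (size {2 + m} smallOrSuffix + 1) + (4 + m)
    ≡⟨ cong (_+ (4 + m)) (size-smallOrSuffix m) ⟩
  (2 + m) C 2 + 2 * (2 + m) + (4 + m)
    ≡⟨ shift ((2 + m) C 2) m ⟩
  (2 + m) + (2 + m) C 2 + 2 * (3 + m)
    ≡⟨ cong (λ k → k + (2 + m) C 2 + 2 * (3 + m)) (sym (nC1≡n (2 + m))) ⟩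
  (2 + m) C 1 + (2 + m) C 2 + 2 * (3 + m)
    ≡⟨ cong (_+ 2 * (3 + m)) (nCk+nC[k+1]≡[n+1]C[k+1] (2 + m) 1) ⟩
  (3 + m) C 2 + 2 * (3 + m) ∎
  where
  open ≡-Reasoning
  regroup : ∀ s m → s + (3 + m + 1) + 1 ≡ (s + 1) + (4 + m)
  regroup = solve-∀
  shift : ∀ c m → c + 2 * (2 + m) + (4 + m) ≡ (2 + m) + c + 2 * (3 + m)
  shift = solve-∀

-- A ⊈ C and C ⊈ A give two distinct points of B, one in A and one in C; as ∣ B ∣ < 3 they exhaust B.
small-upper-bound-⊆ : ∀ {n} {A B C D : Subset n} → ∣ B ∣ < 3 →
  A ⊆ B → C ⊆ B → A ⊈ C → C ⊈ A → A ⊆ D → C ⊆ D → B ⊆ D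
small-upper-bound-⊆ ∣B∣<3 A⊆B C⊆B A⊈C C⊈A A⊆D C⊆D {x} x∈B with ⊈⇒∃∉ A⊈C | ⊈⇒∃∉ C⊈A
... | a , a∈A , a∉C | c , c∈C , c∉A with x ≟ a | x ≟ c
...   | yes refl | _ = A⊆D a∈A
...   | no _ | yes refl = C⊆D c∈C
...   | no x≢a | no x≢c =
  contradiction (three-members⇒3≤∣p∣ (A⊆B a∈A) (C⊆B c∈C) x∈B a≢c (≢-sym x≢a) (≢-sym x≢c)) (<⇒≱ ∣B∣<3)
  where
  a≢c : a ≢ c
  a≢c refl = a∉C c∈C

smallOrSuffix-free : ∀ {n} → ¬ ContainsInducedBowtie (smallOrSuffix {n})
smallOrSuffix-free (f , _ , f∈F , f-bowtie) =
  no-top (to (T-∨ {∣ f ⋈B ∣ <ᵇ 3}) (f∈F ⋈B)) (to (T-∨ {∣ f ⋈D ∣ <ᵇ 3}) (f∈F ⋈D))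
  where
  below : ∀ x y → x ≤⋈ y → f x ⊆ f y
  below x y = to (f-bowtie x y)
  not-below : ∀ x y → ¬ x ≤⋈ y → f x ⊈ f y
  not-below x y x≰y = x≰y ∘ from (f-bowtie x y)
  A⊈C = not-below ⋈A ⋈C (λ ())
  C⊈A = not-below ⋈C ⋈A (λ ())
  B⊈D = not-below ⋈B ⋈D (λ ())
  D⊈B = not-below ⋈D ⋈B (λ ())
  no-top : T (∣ f ⋈B ∣ <ᵇ 3) ⊎ T (isSuffix (f ⋈B)) → T (∣ f ⋈D ∣ <ᵇ 3) ⊎ T (isSuffix (f ⋈D)) → Data.Empty.⊥
  no-top (inj₁ B-small) _ = B⊈D (small-upper-bound-⊆ (<ᵇ⇒< _ 3 B-small)
    (below ⋈A ⋈B tt) (below ⋈C ⋈B tt) A⊈C C⊈A (below ⋈A ⋈D tt) (below ⋈C ⋈D tt))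
  no-top _ (inj₁ D-small) = D⊈B (small-upper-bound-⊆ (<ᵇ⇒< _ 3 D-small)
    (below ⋈A ⋈D tt) (below ⋈C ⋈D tt) A⊈C C⊈A (below ⋈A ⋈B tt) (below ⋈C ⋈B tt))
  no-top (inj₂ B-suffix) (inj₂ D-suffix) = [ B⊈D , D⊈B ] (suffixes-chain _ _ B-suffix D-suffix)

-- D is the suffix starting just after the least point of S.
crossing-suffix : ∀ {n} (S : Subset n) → 3 ≤ ∣ S ∣ → ¬ T (isSuffix S) →
  ∃ λ D → T (isSuffix D) × D ⊈ S × S ⊈ D × 2 ≤ ∣ S ∩ D ∣
crossing-suffix (outside ∷ S) 3≤∣S∣ S-not-suffix with crossing-suffix S 3≤∣S∣ S-not-suffix
... | D , D-suffix , D⊈S , S⊈D , 2≤∣S∩D∣ =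
  outside ∷ D , D-suffix , D⊈S ∘ drop-∷-⊆ , S⊈D ∘ drop-∷-⊆ , 2≤∣S∩D∣
crossing-suffix {suc n} (inside ∷ S) (s≤s 2≤∣S∣) S-not-full with ¬isFull⇒∃∉ S-not-full
... | x , x∉S =
  outside ∷ ⊤ , isFull⇒isSuffix {p = ⊤ {n}} (isFull-⊤ n) , (λ D⊆S → x∉S (drop-there (D⊆S (there ∈⊤)))) ,
  (λ S⊆D → contradiction (S⊆D here) λ ()) , subst (λ p → 2 ≤ ∣ p ∣) (sym (∩-identityʳ S)) 2≤∣S∣

⁅x⁆∈smallOrSuffix : ∀ {n} (x : Fin n) → T (smallOrSuffix ⁅ x ⁆)
⁅x⁆∈smallOrSuffix x = from (T-∨ {∣ ⁅ x ⁆ ∣ <ᵇ 3}) (inj₁ (subst (λ k → T (k <ᵇ 3)) (sym (∣⁅x⁆∣≡1 x)) tt))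

∉smallOrSuffix : ∀ {n} (S : Subset n) → ¬ T (smallOrSuffix S) → 3 ≤ ∣ S ∣ × ¬ T (isSuffix S)
∉smallOrSuffix S S∉F =
  ≮⇒≥ (S∉F ∘ from (T-∨ {∣ S ∣ <ᵇ 3}) ∘ inj₁ ∘ <⇒<ᵇ) , S∉F ∘ from (T-∨ {∣ S ∣ <ᵇ 3}) ∘ inj₂

smallOrSuffix-saturating : ∀ {n} (F' : Family n) → smallOrSuffix ⊂F F' → ContainsInducedBowtie F'
smallOrSuffix-saturating F' (⊆F' , S , S∈F' , S∉F) with ∉smallOrSuffix S S∉F
... | 3≤∣S∣ , S-not-suffix with crossing-suffix S 3≤∣S∣ S-not-suffix
... | D , D-suffix , D⊈S , S⊈D , 2≤∣S∩D∣ with 2≤∣p∣⇒two-members 2≤∣S∩D∣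
... | a , c , a≢c , a∈S∩D , c∈S∩D with x∈p∩q⁻ S D a∈S∩D | x∈p∩q⁻ S D c∈S∩D
... | a∈S , a∈D | c∈S , c∈D = induced-copy {F = F'} bowtie in-F'
  where
  c≢a = ≢-sym a≢c
  bowtie : IsBowtie ⟨ ⁅ a ⁆ , S , ⁅ c ⁆ , D ⟩
  bowtie = IsBowtie-intro
    (x∈p⇒⁅x⁆⊆p a∈S) (x∈p⇒⁅x⁆⊆p a∈D) (x∈p⇒⁅x⁆⊆p c∈S) (x∈p⇒⁅x⁆⊆p c∈D)
    (∈∧≢⇒⊈⁅⁆ (x∈⁅x⁆ a) a≢c) (∈∧≢⇒⊈⁅⁆ (x∈⁅x⁆ c) c≢a) S⊈D D⊈S
    (∈∧≢⇒⊈⁅⁆ c∈S c≢a) (∈∧≢⇒⊈⁅⁆ a∈S a≢c) (∈∧≢⇒⊈⁅⁆ c∈D c≢a) (∈∧≢⇒⊈⁅⁆ a∈D a≢c)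
  in-F' : ∀ x → T (F' (⟨ ⁅ a ⁆ , S , ⁅ c ⁆ , D ⟩ x))
  in-F' ⋈A = ⊆F' _ (⁅x⁆∈smallOrSuffix a)
  in-F' ⋈B = S∈F'
  in-F' ⋈C = ⊆F' _ (⁅x⁆∈smallOrSuffix c)
  in-F' ⋈D = ⊆F' D (from (T-∨ {∣ D ∣ <ᵇ 3}) (inj₂ D-suffix))

theorem7 : (n : ℕ) → 3 ≤ n →
    ((F : Family n) → InducedBowtieSaturated F → ⌈log₂ n ⌉ ≤ size F) ×
    Σ (Family n) (λ F → InducedBowtieSaturated F × size F ≤ (n C 2) + 2 * n ∸ 1)
theorem7 zero ()
theorem7 (suc zero) (s≤s ())
theorem7 (suc (suc m)) _ =
  (λ F F-saturated → ≤-trans (⌈log₂⌉-mono-≤ (saturated⇒n≤2^size F-saturated)) (≤-reflexive (⌈log₂2^n⌉≡n (size F)))) ,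
  smallOrSuffix ,
  (smallOrSuffix-free , smallOrSuffix-saturating) ,
  ≤-reflexive (trans (sym (m+n∸n≡m _ 1)) (cong (_∸ 1) (size-smallOrSuffix m)))
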